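{- Let $X$ be a layer-latin cube of order $5$, let $A$ be the $2$-layer latin cuboid formed by two of its layers and $A'$ the $3$-layer latin cuboid formed by its other three layers. If there exist labels $i,j\in\{1,\dots,10\}$ with $T(A)(i,j)+T(A')(i,j)\ge 11$, then $X$ has a transversal.
   Context: $Q_5=\{0,\dots,4\}$. A layer-latin cube of order $5$ is an array $X$ with cells $(l,r,c)$, $l,r,c\in Q_5$ (layer, row, column) and entries in $Q_5$, each layer being a latin square of order $5$; a $k$-layer latin cuboid is the analogous array with $k$ layers, the layers keeping their row and column coordinates. A transversal of $X$ is a set of $5$ cells with pairwise distinct layers, pairwise distinct rows, pairwise distinct columns and pairwise distinct symbols. Fix a numbering $S_1,\dots,S_{10}$ of the $2$-element subsets of $Q_5$; the label of a $3$-element subset is the label of its complement. For an array with $m$ layers and label sets, a diagonal of an $m\times m\times m$ array is a set of $m$ cells any two of which differ in all three coordinates; a transversal of it is a diagonal whose symbols are pairwise distinct, and its range is the set of its symbols. For a $2$-layer latin cuboid $A$ of order $5$, $T(A)(i,j)$ is the number of distinct ranges of transversals of the $2\times2\times2$ subarray of $A$ with rows in $S_i$ and columns in $S_j$. For a $3$-layer latin cuboid $A'$ of order $5$, $T(A')(i,j)$ is the number of distinct ranges of transversals of the $3\times3\times3$ subarray of $A'$ with rows in $Q_5\setminus S_i$ and columns in $Q_5\setminus S_j$. -}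

module Defs where

open import Data.Nat using (ℕ; _+_; _≤_)
open import Data.Fin using (Fin)
open import Data.Fin.Subset using (Subset; inside; outside; _∈_; ∁; ∣_∣)
open import Data.Vec using (_∷_; [])
open import Data.List using (List; length)
import Data.List.Membership.Propositional as LMem
open import Data.List.Relation.Unary.Unique.Propositional using (Unique)
open import Data.Product using (Σ; ∃; _×_; _,_)
open import Relation.Binary.PropositionalEquality using (_≡_; _≢_)
open import Relation.Nullary using (¬_)

Q5 : Set
Q5 = Fin 5

-- A layer-latin cube of order 5: X l r c is the symbol in cell (layer l, row r, column c).
Cube : Set
Cube = Q5 → Q5 → Q5 → Q5

-- every layer is a latin square of order 5 (injectivity in rows and in columns
-- suffices over the finite set Q5)
LayerLatin : Cube → Set
LayerLatin X =
  (∀ l r c c′ → X l r c ≡ X l r c′ → c ≡ c′) ×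
  (∀ l r r′ c → X l r c ≡ X l r′ c → r ≡ r′)

record Cell : Set where
  constructor cell
  field
    lay : Q5
    row : Q5
    col : Q5
open Cell public

sym : Cube → Cell → Q5
sym X (cell l r c) = X l r c

IsDiagonal : (m : ℕ) → Subset 5 → Subset 5 → Subset 5 → (Fin m → Cell) → Set
IsDiagonal m Ls Rs Cs d =
  (∀ k → lay (d k) ∈ Ls × row (d k) ∈ Rs × col (d k) ∈ Cs) ×
  (∀ a b → a ≢ b → lay (d a) ≢ lay (d b) × row (d a) ≢ row (d b) × col (d a) ≢ col (d b))

IsTransversal : Cube → (m : ℕ) → Subset 5 → Subset 5 → Subset 5 → (Fin m → Cell) → Set
IsTransversal X m Ls Rs Cs d =
  IsDiagonal m Ls Rs Cs d × (∀ a b → a ≢ b → sym X (d a) ≢ sym X (d b))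

HasRange : Cube → {m : ℕ} → (Fin m → Cell) → Subset 5 → Set
HasRange X {m} d R = ∀ s → (s ∈ R → ∃ λ k → sym X (d k) ≡ s) × ((∃ λ k → sym X (d k) ≡ s) → s ∈ R)

IsRangeOfTransversal : Cube → (m : ℕ) → Subset 5 → Subset 5 → Subset 5 → Subset 5 → Set
IsRangeOfTransversal X m Ls Rs Cs R =
  Σ (Fin m → Cell) λ d → IsTransversal X m Ls Rs Cs d × HasRange X d R

HasCard : (Subset 5 → Set) → ℕ → Set
HasCard P n =
  Σ (List (Subset 5)) λ xs →
    length xs ≡ n × Unique xs × (∀ R → (R LMem.∈ xs → P R) × (P R → R LMem.∈ xs))

-- the fixed numbering S_1,…,S_10 (here indexed by Fin 10) of the 2-subsets of Q5
S : Fin 10 → Subset 5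
S Fin.zero = inside ∷ inside ∷ outside ∷ outside ∷ outside ∷ []
S (Fin.suc Fin.zero) = inside ∷ outside ∷ inside ∷ outside ∷ outside ∷ []
S (Fin.suc (Fin.suc Fin.zero)) = inside ∷ outside ∷ outside ∷ inside ∷ outside ∷ []
S (Fin.suc (Fin.suc (Fin.suc Fin.zero))) = inside ∷ outside ∷ outside ∷ outside ∷ inside ∷ []
S (Fin.suc (Fin.suc (Fin.suc (Fin.suc Fin.zero)))) = outside ∷ inside ∷ inside ∷ outside ∷ outside ∷ []
S (Fin.suc (Fin.suc (Fin.suc (Fin.suc (Fin.suc Fin.zero))))) = outside ∷ inside ∷ outside ∷ inside ∷ outside ∷ []
S (Fin.suc (Fin.suc (Fin.suc (Fin.suc (Fin.suc (Fin.suc Fin.zero)))))) = outside ∷ inside ∷ outside ∷ outside ∷ inside ∷ []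
S (Fin.suc (Fin.suc (Fin.suc (Fin.suc (Fin.suc (Fin.suc (Fin.suc Fin.zero))))))) = outside ∷ outside ∷ inside ∷ inside ∷ outside ∷ []
S (Fin.suc (Fin.suc (Fin.suc (Fin.suc (Fin.suc (Fin.suc (Fin.suc (Fin.suc Fin.zero)))))))) = outside ∷ outside ∷ inside ∷ outside ∷ inside ∷ []
S (Fin.suc (Fin.suc (Fin.suc (Fin.suc (Fin.suc (Fin.suc (Fin.suc (Fin.suc (Fin.suc Fin.zero))))))))) = outside ∷ outside ∷ outside ∷ inside ∷ inside ∷ []

-- Given the 2-set L of layers forming A (the other three layers form A′):
-- T(A)(i,j) = t  : 2×2×2 subarray, layers L, rows S i, columns S j
TA : Cube → Subset 5 → Fin 10 → Fin 10 → ℕ → Set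
TA X L i j t = HasCard (IsRangeOfTransversal X 2 L (S i) (S j)) t

TA′ : Cube → Subset 5 → Fin 10 → Fin 10 → ℕ → Set
TA′ X L i j t = HasCard (IsRangeOfTransversal X 3 (∁ L) (∁ (S i)) (∁ (S j))) t

HasTransversal : Cube → Set
HasTransversal X =
  Σ (Fin 5 → Cell) λ d → IsTransversal X 5 (∁ []ₛ) (∁ []ₛ) (∁ []ₛ) d
  where open Data.Fin.Subset using () renaming (⊥ to []ₛ)

-- The range of a transversal of the 2×2×2 subarray of A is a 2-set of symbols, and
-- the complement of the range of a transversal of the 3×3×3 subarray of A′ is a 2-set
-- as well. There are only ten 2-sets, so if t + t′ ≥ 11 some 2-set R is the range of a
-- transversal d of the first subarray while its complement is the range of a
-- transversal e of the second. The two subarrays use complementary sets of layers,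
-- rows and columns, and d, e use complementary sets of symbols, so d ∪ e is a
-- transversal of X.
module Submission where

open import Defs
open import Data.Nat using (ℕ; zero; suc; _+_; _∸_; _≤_; _<_; s≤s; z≤n) renaming (_≟_ to _≟ⁿ_)
open import Data.Nat.Properties using (<⇒≱; module ≤-Reasoning)
open import Data.Bool.Properties using () renaming (_≟_ to _≟ᵇ_)
open import Data.Fin using (Fin; zero; suc; splitAt; join)
open import Data.Fin.Properties using (_≟_; 0≢1+n; suc-injective; join-splitAt)
open import Data.Fin.Subset
  using (Subset; ⊥; ⊤; ⁅_⁆; _∪_; ∁; _∈_; _∉_; _⊆_; ∣_∣; inside; outside)
open import Data.Fin.Subset.Properties
  using ( ∉⊥; ∈⊤; x∈⁅x⁆; x∈⁅y⁆⇒x≡y; x∈p∪q⁺; x∈p∪q⁻; ∪-identityˡ; ⊆-antisym; ∣⊥∣≡0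
        ; ∣∁p∣≡n∸∣p∣; x∈p⇒x∉∁p; x∈∁p⇒x∉p; x∉∁p⇒x∈p; anySubset? )
open import Data.List using (List; []; _∷_; _++_; length; map; tabulate)
open import Data.List.Properties using (length-++; length-map; length-removeAt′)
open import Data.List.Relation.Unary.Any using (here; there; any?; index)
import Data.List.Relation.Unary.All as All
open import Data.List.Relation.Unary.AllPairs using (_∷_)
open import Data.List.Relation.Unary.Unique.Propositional using (Unique)
import Data.List.Relation.Unary.Unique.Propositional.Properties as Unique
import Data.List.Membership.Propositional as List
open import Data.List.Membership.Propositional using (find; lose)
open import Data.List.Membership.Propositional.Properties using (∈-map⁻; ∈-++⁻)
import Data.List.Membership.DecPropositional as DecMembership
open import Data.List.Relation.Binary.Subset.Propositional renaming (_⊆_ to _⊆ˡ_)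
open import Data.Vec using (_∷_; here; there)
open import Data.Vec.Properties using (≡-dec)
import Data.Vec.Functional as Vector
open import Data.Product using (∃; _×_; _,_; proj₁; proj₂)
import Data.Product as Product
open import Data.Sum using (inj₁; inj₂; [_,_]; [_,_]′)
open import Function using (_∘_; id)
open import Function.Definitions using (Injective)
open import Relation.Binary.Definitions using (DecidableEquality; Symmetric)
open import Relation.Binary.PropositionalEquality
  using (_≡_; _≢_; refl; cong; cong₂; subst; ≢-sym; module ≡-Reasoning)
import Relation.Binary.PropositionalEquality as ≡
open import Relation.Nullary using (¬_; yes; no; contradiction)
open import Relation.Nullary.Decidable using (¬?; _→-dec_; decidable-stable; from-no)

module _ {A : Set} where

  ∈-─⁺ : ∀ {x y : A} {ys} → y ≢ x → y List.∈ ys → (x∈ys : x List.∈ ys) → y List.∈ ys List.─ x∈ys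
  ∈-─⁺ y≢x (here refl)  (here refl)  = contradiction refl y≢x
  ∈-─⁺ _   (there y∈ys) (here _)     = y∈ys
  ∈-─⁺ _   (here y≡z)   (there _)    = here y≡z
  ∈-─⁺ y≢x (there y∈ys) (there x∈ys) = there (∈-─⁺ y≢x y∈ys x∈ys)

  Unique-⊆⇒length≤ : ∀ {xs ys : List A} → Unique xs → xs ⊆ˡ ys → length xs ≤ length ys
  Unique-⊆⇒length≤ {[]}     _                      _       = z≤n
  Unique-⊆⇒length≤ {x ∷ xs} {ys} (x∉xs ∷ xs-unique) x∷xs⊆ys = begin
    suc (length xs)               ≤⟨ s≤s (Unique-⊆⇒length≤ xs-unique xs⊆ys─x) ⟩
    suc (length (ys List.─ x∈ys)) ≡⟨ ≡.sym (length-removeAt′ ys (index x∈ys)) ⟩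
    length ys                     ∎
    where
    open ≤-Reasoning
    x∈ys : x List.∈ ys
    x∈ys = x∷xs⊆ys (here refl)
    xs⊆ys─x : xs ⊆ˡ ys List.─ x∈ys
    xs⊆ys─x y∈xs = ∈-─⁺ (≢-sym (All.lookup x∉xs y∈xs)) (x∷xs⊆ys (there y∈xs)) x∈ys

module _ {A : Set} (_≟ᴬ_ : DecidableEquality A) where
  open DecMembership _≟ᴬ_ using (_∈?_)

  common-element : ∀ {xs ys zs : List A} → Unique xs → Unique ys → xs ⊆ˡ zs → ys ⊆ˡ zs →
                   length zs < length xs + length ys → ∃ λ x → x List.∈ xs × x List.∈ ys
  common-element {xs} {ys} {zs} xs-unique ys-unique xs⊆zs ys⊆zs zs<xs+ys
    with any? (_∈? ys) xs
  ... | yes xs∩ys≢∅ = find xs∩ys≢∅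
  ... | no  xs∩ys≡∅ = contradiction
    (Unique-⊆⇒length≤ xs++ys-unique ([ xs⊆zs , ys⊆zs ]′ ∘ ∈-++⁻ xs))
    (<⇒≱ (subst (length zs <_) (≡.sym (length-++ xs)) zs<xs+ys))
    where
    xs++ys-unique : Unique (xs ++ ys)
    xs++ys-unique = Unique.++⁺ xs-unique ys-unique
      (λ (v∈xs , v∈ys) → xs∩ys≡∅ (lose v∈xs v∈ys))

image : ∀ {m n} → (Fin m → Fin n) → Subset n
image {zero}  f = ⊥
image {suc m} f = ⁅ f zero ⁆ ∪ image (f ∘ suc)

∈-image⁺ : ∀ {m n} (f : Fin m → Fin n) k → f k ∈ image f
∈-image⁺ f zero    = x∈p∪q⁺ (inj₁ (x∈⁅x⁆ (f zero)))
∈-image⁺ f (suc k) = x∈p∪q⁺ (inj₂ (∈-image⁺ (f ∘ suc) k))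

∈-image⁻ : ∀ {m n} (f : Fin m → Fin n) {x} → x ∈ image f → ∃ λ k → f k ≡ x
∈-image⁻ {zero}  f x∈⊥ = contradiction x∈⊥ ∉⊥
∈-image⁻ {suc m} f x∈image with x∈p∪q⁻ ⁅ f zero ⁆ (image (f ∘ suc)) x∈image
... | inj₁ x∈⁅f0⁆ = zero , ≡.sym (x∈⁅y⁆⇒x≡y (f zero) x∈⁅f0⁆)
... | inj₂ x∈rest = Product.map suc id (∈-image⁻ (f ∘ suc) x∈rest)

∣⁅x⁆∪p∣≡1+∣p∣ : ∀ {n} {x : Fin n} {p : Subset n} → x ∉ p → ∣ ⁅ x ⁆ ∪ p ∣ ≡ suc ∣ p ∣
∣⁅x⁆∪p∣≡1+∣p∣ {x = zero}  {outside ∷ p} _   = cong (suc ∘ ∣_∣) (∪-identityˡ p)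
∣⁅x⁆∪p∣≡1+∣p∣ {x = zero}  {inside  ∷ p} x∉p = contradiction here x∉p
∣⁅x⁆∪p∣≡1+∣p∣ {x = suc x} {outside ∷ p} x∉p = ∣⁅x⁆∪p∣≡1+∣p∣ (x∉p ∘ there)
∣⁅x⁆∪p∣≡1+∣p∣ {x = suc x} {inside  ∷ p} x∉p = cong suc (∣⁅x⁆∪p∣≡1+∣p∣ (x∉p ∘ there))

∣image∣≡m : ∀ {m n} (f : Fin m → Fin n) → Injective _≡_ _≡_ f → ∣ image f ∣ ≡ m
∣image∣≡m {zero}  {n} f _     = ∣⊥∣≡0 n
∣image∣≡m {suc m}     f f-inj = begin
  ∣ ⁅ f zero ⁆ ∪ image (f ∘ suc) ∣ ≡⟨ ∣⁅x⁆∪p∣≡1+∣p∣ f0∉rest ⟩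
  suc ∣ image (f ∘ suc) ∣          ≡⟨ cong suc (∣image∣≡m (f ∘ suc) (suc-injective ∘ f-inj)) ⟩
  suc m                            ∎
  where
  open ≡-Reasoning
  f0∉rest : f zero ∉ image (f ∘ suc)
  f0∉rest f0∈rest = let k , f[1+k]≡f0 = ∈-image⁻ (f ∘ suc) f0∈rest
                    in 0≢1+n (≡.sym (f-inj f[1+k]≡f0))

module _ (X : Cube) where

  ∈-range : ∀ {m} {d : Fin m → Cell} {R} → HasRange X d R → ∀ k → sym X (d k) ∈ R
  ∈-range {d = d} range k = proj₂ (range (sym X (d k))) (k , refl)

  range≡image : ∀ {m} {d : Fin m → Cell} {R} → HasRange X d R → R ≡ image (sym X ∘ d)
  range≡image {d = d} range = ⊆-antisym
    (λ s∈R → let k , dk≡s = proj₁ (range _) s∈R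
             in subst (_∈ image (sym X ∘ d)) dk≡s (∈-image⁺ (sym X ∘ d) k))
    (λ s∈image → proj₂ (range _) (∈-image⁻ (sym X ∘ d) s∈image))

  transversal-symbols-injective : ∀ {m Ls Rs Cs} {d : Fin m → Cell} →
    IsTransversal X m Ls Rs Cs d → Injective _≡_ _≡_ (sym X ∘ d)
  transversal-symbols-injective (_ , distinct) {a} {b} da≡db =
    decidable-stable (a ≟ b) (λ a≢b → distinct a b a≢b da≡db)

  ∣range∣≡m : ∀ {m Ls Rs Cs} {d : Fin m → Cell} {R} →
    IsTransversal X m Ls Rs Cs d → HasRange X d R → ∣ R ∣ ≡ m
  ∣range∣≡m {d = d} d-transversal range = ≡.trans (cong ∣_∣ (range≡image range))
    (∣image∣≡m (sym X ∘ d) (transversal-symbols-injective d-transversal))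

∁-injective : ∀ {n} {p q : Subset n} → ∁ p ≡ ∁ q → p ≡ q
∁-injective ∁p≡∁q = ⊆-antisym (⊆-from ∁p≡∁q) (⊆-from (≡.sym ∁p≡∁q))
  where
  ⊆-from : ∀ {p q : Subset _} → ∁ p ≡ ∁ q → p ⊆ q
  ⊆-from ∁p≡∁q x∈p = x∉∁p⇒x∈p (subst (_ ∉_) ∁p≡∁q (x∈p⇒x∉∁p x∈p))

_≟ˢ_ : DecidableEquality (Subset 5)
_≟ˢ_ = ≡-dec _≟ᵇ_

labels : List (Subset 5)
labels = tabulate S

open DecMembership _≟ˢ_ using (_∈?_)

-- Decided by evaluation over all 32 subsets of Q5.
∣p∣≡2⇒p∈labels : ∀ p → ∣ p ∣ ≡ 2 → p List.∈ labels
∣p∣≡2⇒p∈labels p ∣p∣≡2 = decidable-stable (p ∈? labels)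
  (λ p∉labels → no-counterexample (p , λ p∈ → p∉labels (p∈ ∣p∣≡2)))
  where
  no-counterexample : ¬ ∃ λ p → ¬ (∣ p ∣ ≡ 2 → p List.∈ labels)
  no-counterexample = from-no (anySubset? λ p → ¬? (∣ p ∣ ≟ⁿ 2 →-dec p ∈? labels))

module _ (X : Cube) {Ls Rs Cs : Subset 5} where

  range₂∈labels : ∀ {d R} → IsTransversal X 2 Ls Rs Cs d → HasRange X d R → R List.∈ labels
  range₂∈labels d-transversal d-range = ∣p∣≡2⇒p∈labels _ (∣range∣≡m X d-transversal d-range)

  ∁range₃∈labels : ∀ {e R} → IsTransversal X 3 Ls Rs Cs e → HasRange X e R → ∁ R List.∈ labels
  ∁range₃∈labels {R = R} e-transversal e-range = ∣p∣≡2⇒p∈labels (∁ R) (begin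
    ∣ ∁ R ∣   ≡⟨ ∣∁p∣≡n∸∣p∣ R ⟩
    5 ∸ ∣ R ∣ ≡⟨ cong (5 ∸_) (∣range∣≡m X e-transversal e-range) ⟩
    2         ∎)
    where open ≡-Reasoning

Pairwise : ∀ {ℓ} {A : Set} → (A → A → Set ℓ) → ∀ {m} → (Fin m → A) → Set ℓ
Pairwise P u = ∀ a b → a ≢ b → P (u a) (u b)

++-pairwise : ∀ {ℓ} {A : Set} {P : A → A → Set ℓ} {m n} {u : Fin m → A} {v : Fin n → A} →
  Symmetric P → Pairwise P u → Pairwise P v → (∀ a b → P (u a) (v b)) →
  Pairwise P (u Vector.++ v)
++-pairwise {P = P} {m} {n} {u} {v} P-sym Pu Pv Puv a b a≢b =
  [u,v]-pairwise (splitAt m a) (splitAt m b) (a≢b ∘ splitAt-injective)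
  where
  open ≡-Reasoning
  splitAt-injective : splitAt m a ≡ splitAt m b → a ≡ b
  splitAt-injective eq = begin
    a                      ≡⟨ ≡.sym (join-splitAt m n a) ⟩
    join m n (splitAt m a) ≡⟨ cong (join m n) eq ⟩
    join m n (splitAt m b) ≡⟨ join-splitAt m n b ⟩
    b                      ∎
  [u,v]-pairwise : ∀ x y → x ≢ y → P ([ u , v ] x) ([ u , v ] y)
  [u,v]-pairwise (inj₁ a) (inj₁ b) x≢y = Pu a b (x≢y ∘ cong inj₁)
  [u,v]-pairwise (inj₁ a) (inj₂ b) _   = Puv a b
  [u,v]-pairwise (inj₂ a) (inj₁ b) _   = P-sym (Puv b a)
  [u,v]-pairwise (inj₂ a) (inj₂ b) x≢y = Pv a b (x≢y ∘ cong inj₂)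

Apart : Cell → Cell → Set
Apart c c′ = lay c ≢ lay c′ × row c ≢ row c′ × col c ≢ col c′

Apart-sym : Symmetric Apart
Apart-sym (l≢l′ , r≢r′ , c≢c′) = ≢-sym l≢l′ , ≢-sym r≢r′ , ≢-sym c≢c′

∈∧∈∁⇒≢ : ∀ {n} {p : Subset n} {x y} → x ∈ p → y ∈ ∁ p → x ≢ y
∈∧∈∁⇒≢ x∈p y∈∁p refl = x∈∁p⇒x∉p y∈∁p x∈p

++-isTransversal : ∀ (X : Cube) {m n Ls Rs Cs} {d : Fin m → Cell} {e : Fin n → Cell} →
  IsTransversal X m Ls Rs Cs d → IsTransversal X n (∁ Ls) (∁ Rs) (∁ Cs) e →
  (∀ a b → sym X (d a) ≢ sym X (e b)) → IsTransversal X (m + n) ⊤ ⊤ ⊤ (d Vector.++ e)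
++-isTransversal X {d = d} {e} ((d-in , d-apart) , d-distinct) ((e-in , e-apart) , e-distinct) de-distinct =
  ((λ _ → ∈⊤ , ∈⊤ , ∈⊤) , ++-pairwise {P = Apart} Apart-sym d-apart e-apart de-apart) ,
  ++-pairwise {P = λ c c′ → sym X c ≢ sym X c′} ≢-sym d-distinct e-distinct de-distinct
  where
  de-apart : ∀ a b → Apart (d a) (e b)
  de-apart a b =
    let l∈ , r∈ , c∈ = d-in a ; l′∈ , r′∈ , c′∈ = e-in b
    in ∈∧∈∁⇒≢ l∈ l′∈ , ∈∧∈∁⇒≢ r∈ r′∈ , ∈∧∈∁⇒≢ c∈ c′∈

proposition7 : (X : Cube) → LayerLatin X →
    (L : Subset 5) → ∣ L ∣ ≡ 2 →
    (i j : Fin 10) → (t t′ : ℕ) → TA X L i j t → TA′ X L i j t′ →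
    11 ≤ t + t′ → HasTransversal X
proposition7 X _ _ _ _ _ t t′ (xs , ∣xs∣≡t , xs-unique , xs-ranges)
                                 (ys , ∣ys∣≡t′ , ys-unique , ys-ranges) 11≤t+t′ =
  let R , R∈xs , R∈∁ys = common-element _≟ˢ_ xs-unique (Unique.map⁺ ∁-injective ys-unique)
                           xs⊆labels ∁ys⊆labels 10<∣xs∣+∣∁ys∣
      R′ , R′∈ys , R≡∁R′ = ∈-map⁻ ∁ R∈∁ys
      d , d-transversal , d-range = proj₁ (xs-ranges R) R∈xs
      e , e-transversal , e-range = proj₁ (ys-ranges R′) R′∈ys
  in d Vector.++ e , ++-isTransversal X d-transversal e-transversal λ a b →
       ≢-sym (∈∧∈∁⇒≢ (∈-range X e-range b) (subst (sym X (d a) ∈_) R≡∁R′ (∈-range X d-range a)))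
  where
  xs⊆labels : xs ⊆ˡ labels
  xs⊆labels R∈xs = let _ , d-transversal , d-range = proj₁ (xs-ranges _) R∈xs
                   in range₂∈labels X d-transversal d-range
  ∁ys⊆labels : map ∁ ys ⊆ˡ labels
  ∁ys⊆labels R∈∁ys =
    let R′ , R′∈ys , R≡∁R′ = ∈-map⁻ ∁ R∈∁ys
        _ , e-transversal , e-range = proj₁ (ys-ranges R′) R′∈ys
    in subst (List._∈ labels) (≡.sym R≡∁R′) (∁range₃∈labels X e-transversal e-range)
  10<∣xs∣+∣∁ys∣ : length labels < length xs + length (map ∁ ys)
  10<∣xs∣+∣∁ys∣ = subst (10 <_) (≡.sym (cong₂ _+_ ∣xs∣≡t (≡.trans (length-map ∁ ys) ∣ys∣≡t′))) 11≤t+t′
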